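{- Let $n,M$ be positive integers, $a$ an integer, and $V$ an affine subspace of $\mathbb F_2^n$. Let $N(V,a,M)=|\{x\in V:\mathsf{Ham}(x)\equiv a\pmod M\}|$. If $N(V,a,M)\neq0$ then $N(V,a,M)\ge |V|/2^{\mathcal D(n,M)+1}$.
   Context: $\mathsf{Ham}(x)$ is the Hamming weight (number of ones) of $x\in\mathbb F_2^n$. $\mathcal D(n,M)$ denotes the largest dimension of an affine subspace $C$ of $\mathbb F_2^n$ such that for some $0\le a\le M$ there exists exactly one point $x_0\in C$ with $\mathsf{Ham}(x_0)\equiv a\pmod M$. -}

module Defs where

open import Data.Bool using (Bool; true; false; _xor_; if_then_else_)
open import Data.Bool.Properties using () renaming (_≟_ to _≟B_)
open import Data.Nat using (ℕ; zero; suc; _+_)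
open import Data.Integer using (ℤ; +_; _-_)
open import Data.Integer.Divisibility.Signed using (_∣_; _∣?_)
open import Data.List using (List; []; _∷_; _++_; map; filter; length)
open import Data.List.Relation.Unary.Any using (Any; any?)
open import Data.Vec using (Vec; []; _∷_; zipWith; replicate; foldr)
open import Data.Vec.Properties using (≡-dec)
open import Data.Product using (Σ; _×_; _,_)
open import Relation.Binary.PropositionalEquality using (_≡_)
open import Relation.Nullary using (Dec; _×-dec_)

F2^ : ℕ → Set
F2^ n = Vec Bool n

_⊕_ : ∀ {n} → F2^ n → F2^ n → F2^ n
_⊕_ = zipWith _xor_

𝟎 : ∀ {n} → F2^ n
𝟎 = replicate _ false

Ham : ∀ {n} → F2^ n → ℕ
Ham = foldr _ (λ b r → (if b then 1 else 0) + r) 0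

allVecs : (n : ℕ) → List (F2^ n)
allVecs zero = [] ∷ []
allVecs (suc n) = map (false ∷_) (allVecs n) ++ map (true ∷_) (allVecs n)

combo : ∀ {n k} → Vec (F2^ n) k → F2^ k → F2^ n
combo [] [] = 𝟎
combo (g ∷ gs) (c ∷ cs) = (if c then g else 𝟎) ⊕ combo gs cs

-- An affine subspace of F_2^n of dimension k:  base + span(gens),
-- with gens linearly independent over F_2 (so dim = k).
record Affine (n : ℕ) : Set where
  field
    dim         : ℕ
    base        : F2^ n
    gens        : Vec (F2^ n) dim
    independent : ∀ c → combo gens c ≡ 𝟎 → c ≡ 𝟎

open Affine public

_∈A_ : ∀ {n} → F2^ n → Affine n → Set
x ∈A V = Any (λ c → x ≡ base V ⊕ combo (gens V) c) (allVecs (dim V))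

_∈A?_ : ∀ {n} (x : F2^ n) (V : Affine n) → Dec (x ∈A V)
x ∈A? V = any? (λ c → ≡-dec _≟B_ x (base V ⊕ combo (gens V) c)) (allVecs (dim V))

HamCong : ∀ {n} → F2^ n → ℤ → ℕ → Set
HamCong x a M = (+ M) ∣ ((+ Ham x) - a)

card : ∀ {n} → Affine n → ℕ
card {n} V = length (filter (λ x → x ∈A? V) (allVecs n))

N : ∀ {n} → Affine n → ℤ → ℕ → ℕ
N {n} V a M =
  length (filter (λ x → (x ∈A? V) ×-dec ((+ M) ∣? ((+ Ham x) - a))) (allVecs n))

Isolating : ∀ {n} → ℕ → Affine n → Set
Isolating M C = Σ ℕ λ a → (a Data.Nat.≤ M) × (N C (+ a) M ≡ 1)

Is𝒟 : ℕ → ℕ → ℕ → Set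
Is𝒟 n M d =
  (Σ (Affine n) λ C → (dim C ≡ d) × Isolating M C)
  × (∀ (C : Affine n) → Isolating M C → dim C Data.Nat.≤ d)

module Submission where

-- If the affine space V contains exactly one point whose Hamming weight is ≡ a (mod M), it is
-- isolating for the residue a mod M, so dim V ≤ D. Otherwise two such points have coefficient
-- vectors differing in some coordinate i, and V splits into the two halves on which that
-- coefficient is 0 resp. 1, each again containing such a point. Induction on dim V therefore
-- gives |V| ≤ N(V,a,M)·2^D, a factor 2 better than claimed.

open import Defs
open import Data.Nat using (ℕ; zero; suc; _≤_; _*_; _^_; _+_; _≟_; NonZero)
open import Data.Integer using (ℤ; +_; _-_) renaming (_+_ to _+ℤ_; _*_ to _*ℤ_)

open import Algebra.Bundles using (AbelianGroup)
import Algebra.Properties.AbelianGroup as AbelianGroupProperties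
import Algebra.Properties.CommutativeSemigroup as CommutativeSemigroupProperties
open import Data.Bool using (Bool; true; false; _xor_; if_then_else_)
open import Data.Bool.Properties
  using (xor-same; xor-assoc; xor-comm; xor-identityˡ; xor-identityʳ; ¬-not)
  renaming (_≟_ to _≟ᵇ_)
open import Data.Nat.Properties
  using ( +-identityʳ; *-identityˡ; *-distribʳ-+; +-mono-≤; *-monoʳ-≤; ^-monoʳ-≤; m≤m+n
        ; m+n≡0⇒m≡0; m+n≡0⇒n≡0; <⇒≤; +-commutativeSemigroup; module ≤-Reasoning )
open import Data.Integer.Divisibility.Signed using (_∣_; _∣?_; ∣m∣n⇒∣m+n; ∣m+n∣n⇒∣m; ∣n⇒∣m*n; ∣-refl)
open import Data.Integer.DivMod using (_%ℕ_; _/ℕ_; a≡a%ℕn+[a/ℕn]*n; n%ℕd<d)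
open import Data.Integer.Solver using (module +-*-Solver)
open import Data.Fin using (Fin; zero; suc)
open import Data.Fin.Properties using (¬∀⟶∃¬)
open import Data.List using (List; []; _∷_; _++_; map; filter; length)
open import Data.List.Properties using (length-++; filter-++; filter-≐)
open import Data.List.Membership.Propositional using (_∈_; lose)
open import Data.List.Membership.Propositional.Properties using (∈-map⁺; ∈-++⁺ˡ; ∈-++⁺ʳ)
open import Data.List.Relation.Unary.Any using (here; any?; satisfied)
open import Data.Vec using (Vec; []; _∷_; lookup; insertAt; removeAt)
open import Data.Vec.Properties
  using ( ≡-dec; zipWith-assoc; zipWith-comm; zipWith-identityˡ; zipWith-identityʳ; ∷-injectiveʳ
        ; removeAt-insertAt; insertAt-removeAt; tabulate∘lookup; tabulate-cong )
open import Data.Product using (∃; ∃₂; _×_; _,_; proj₁)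
open import Data.Sum using (_⊎_; inj₁; inj₂)
open import Data.Unit using (tt)
open import Function using (_∘_; id; _⇔_; mk⇔; Equivalence)
open import Level using (Level; 0ℓ)
open import Relation.Binary.Definitions using (DecidableEquality)
open import Relation.Binary.PropositionalEquality
  using (_≡_; _≢_; refl; sym; trans; cong; cong₂; subst; isEquivalence; module ≡-Reasoning)
open import Relation.Nullary using (Dec; yes; no; ¬_; ¬?; _×-dec_; contradiction)
open import Relation.Nullary.Decidable using (map′; decidable-stable)
open import Relation.Unary using (Pred; Decidable)

open CommutativeSemigroupProperties +-commutativeSemigroup using () renaming (interchange to +-interchange)

private variable
  ℓ : Level
  A B : Set ℓ
  n k : ℕ

𝟙 : Dec A → ℕ
𝟙 (yes _) = 1
𝟙 (no _)  = 0

𝟙-yes : (A? : Dec A) → A → 𝟙 A? ≡ 1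
𝟙-yes (yes _) _ = refl
𝟙-yes (no ¬a) a = contradiction a ¬a

𝟙-no : (A? : Dec A) → ¬ A → 𝟙 A? ≡ 0
𝟙-no (yes a) ¬a = contradiction a ¬a
𝟙-no (no _)  _  = refl

𝟙≢0⇒ : (A? : Dec A) → 𝟙 A? ≢ 0 → A
𝟙≢0⇒ (yes a) _    = a
𝟙≢0⇒ (no _)  𝟙≢0 = contradiction refl 𝟙≢0

𝟙-×-dec : (A? : Dec A) (B? : Dec B) → 𝟙 (A? ×-dec B?) ≡ 𝟙 A? * 𝟙 B?
𝟙-×-dec (yes _) (yes _) = refl
𝟙-×-dec (yes _) (no _)  = refl
𝟙-×-dec (no _)  (yes _) = refl
𝟙-×-dec (no _)  (no _)  = refl

∑ : ∀ k → (F2^ k → ℕ) → ℕ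
∑ zero    f = f []
∑ (suc k) f = ∑ k (λ x → f (false ∷ x)) + ∑ k (λ x → f (true ∷ x))

∑-cong : ∀ k {f g : F2^ k → ℕ} → (∀ x → f x ≡ g x) → ∑ k f ≡ ∑ k g
∑-cong zero    f≗g = f≗g []
∑-cong (suc k) f≗g = cong₂ _+_ (∑-cong k (f≗g ∘ (false ∷_))) (∑-cong k (f≗g ∘ (true ∷_)))

∑-zero : ∀ k {f : F2^ k → ℕ} → (∀ x → f x ≡ 0) → ∑ k f ≡ 0
∑-zero zero    f≗0 = f≗0 []
∑-zero (suc k) f≗0 = cong₂ _+_ (∑-zero k (f≗0 ∘ (false ∷_))) (∑-zero k (f≗0 ∘ (true ∷_)))

∑-one : ∀ k → ∑ k (λ _ → 1) ≡ 2 ^ k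
∑-one zero    = refl
∑-one (suc k) = cong₂ _+_ (∑-one k) (trans (∑-one k) (sym (+-identityʳ (2 ^ k))))

∑-distrib-+ : ∀ k (f g : F2^ k → ℕ) → ∑ k (λ x → f x + g x) ≡ ∑ k f + ∑ k g
∑-distrib-+ zero    f g = refl
∑-distrib-+ (suc k) f g =
  trans (cong₂ _+_ (∑-distrib-+ k (f ∘ (false ∷_)) (g ∘ (false ∷_)))
                   (∑-distrib-+ k (f ∘ (true ∷_)) (g ∘ (true ∷_))))
        (+-interchange (∑ k (f ∘ (false ∷_))) (∑ k (g ∘ (false ∷_)))
                       (∑ k (f ∘ (true ∷_)))  (∑ k (g ∘ (true ∷_))))

∑-distribʳ-* : ∀ k (f : F2^ k → ℕ) t → ∑ k f * t ≡ ∑ k (λ x → f x * t)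
∑-distribʳ-* zero    f t = refl
∑-distribʳ-* (suc k) f t =
  trans (*-distribʳ-+ t (∑ k _) (∑ k _)) (cong₂ _+_ (∑-distribʳ-* k _ t) (∑-distribʳ-* k _ t))

∑-comm : ∀ k m (h : F2^ k → F2^ m → ℕ) →
         ∑ k (λ x → ∑ m (h x)) ≡ ∑ m (λ y → ∑ k (λ x → h x y))
∑-comm zero    m h = refl
∑-comm (suc k) m h = trans (cong₂ _+_ (∑-comm k m _) (∑-comm k m _)) (sym (∑-distrib-+ m _ _))

∑-single : ∀ k (f : F2^ k → ℕ) y → (∀ x → x ≢ y → f x ≡ 0) → ∑ k f ≡ f y
∑-single zero    f []          _      = refl
∑-single (suc k) f (false ∷ y) vanish = trans
  (cong₂ _+_ (∑-single k _ y (λ x x≢y → vanish _ (x≢y ∘ ∷-injectiveʳ))) (∑-zero k (λ x → vanish _ λ ())))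
  (+-identityʳ _)
∑-single (suc k) f (true ∷ y)  vanish =
  cong₂ _+_ (∑-zero k (λ x → vanish _ λ ())) (∑-single k _ y (λ x x≢y → vanish _ (x≢y ∘ ∷-injectiveʳ)))

∑-insertAt : ∀ k (f : F2^ (suc k) → ℕ) (i : Fin (suc k)) →
             ∑ (suc k) f ≡ ∑ k (λ c → f (insertAt c i false)) + ∑ k (λ c → f (insertAt c i true))
∑-insertAt k       f zero    = refl
∑-insertAt (suc k) f (suc i) =
  trans (cong₂ _+_ (∑-insertAt k (f ∘ (false ∷_)) i) (∑-insertAt k (f ∘ (true ∷_)) i))
        (+-interchange (∑ k (λ c → f (false ∷ insertAt c i false))) (∑ k (λ c → f (false ∷ insertAt c i true)))
                       (∑ k (λ c → f (true ∷ insertAt c i false)))  (∑ k (λ c → f (true ∷ insertAt c i true))))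

term≢0⇒∑≢0 : ∀ k (f : F2^ k → ℕ) x → f x ≢ 0 → ∑ k f ≢ 0
term≢0⇒∑≢0 zero    f []          fx≢0 = fx≢0
term≢0⇒∑≢0 (suc k) f (false ∷ x) fx≢0 = term≢0⇒∑≢0 k _ x fx≢0 ∘ m+n≡0⇒m≡0 _
term≢0⇒∑≢0 (suc k) f (true ∷ x)  fx≢0 = term≢0⇒∑≢0 k _ x fx≢0 ∘ m+n≡0⇒n≡0 (∑ k _)

∈-allVecs : (x : F2^ k) → x ∈ allVecs k
∈-allVecs []          = here refl
∈-allVecs (false ∷ x) = ∈-++⁺ˡ (∈-map⁺ (false ∷_) (∈-allVecs x))
∈-allVecs (true ∷ x)  = ∈-++⁺ʳ _ (∈-map⁺ (true ∷_) (∈-allVecs x))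

∃? : {P : Pred (F2^ k) ℓ} → Decidable P → Dec (∃ P)
∃? {k} P? = map′ satisfied (λ (x , px) → lose (∈-allVecs x) px) (any? P? (allVecs k))

∑≢0⇒∃ : ∀ k (f : F2^ k → ℕ) → ∑ k f ≢ 0 → ∃ λ x → f x ≢ 0
∑≢0⇒∃ k f ∑≢0 with ∃? (λ x → ¬? (f x ≟ 0))
... | yes found = found
... | no  none  = contradiction (∑-zero k (λ x → decidable-stable (f x ≟ 0) (none ∘ (x ,_)))) ∑≢0

⊕-self : (x : F2^ n) → x ⊕ x ≡ 𝟎
⊕-self []      = refl
⊕-self (b ∷ x) = cong₂ _∷_ (xor-same b) (⊕-self x)

⊕-abelianGroup : ℕ → AbelianGroup 0ℓ 0ℓ
⊕-abelianGroup n = record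
  { Carrier        = F2^ n
  ; _≈_            = _≡_
  ; _∙_            = _⊕_
  ; ε              = 𝟎
  ; _⁻¹            = id
  ; isAbelianGroup = record
    { isGroup = record
      { isMonoid = record
        { isSemigroup = record
          { isMagma = record { isEquivalence = isEquivalence ; ∙-cong = cong₂ _⊕_ }
          ; assoc   = zipWith-assoc xor-assoc }
        ; identity = zipWith-identityˡ xor-identityˡ , zipWith-identityʳ xor-identityʳ }
      ; inverse = ⊕-self , ⊕-self
      ; ⁻¹-cong = id }
    ; comm = zipWith-comm xor-comm } }

module _ {n : ℕ} where
  open AbelianGroup (⊕-abelianGroup n) public
    using () renaming (assoc to ⊕-assoc; identityˡ to ⊕-identityˡ; identityʳ to ⊕-identityʳ)
  open AbelianGroupProperties (⊕-abelianGroup n) public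
    using () renaming (∙-cancelˡ to ⊕-cancelˡ; x∙y⁻¹≈ε⇒x≈y to ⊕≡𝟎⇒≡)
  open CommutativeSemigroupProperties (AbelianGroup.commutativeSemigroup (⊕-abelianGroup n)) public
    using () renaming (interchange to ⊕-interchange; x∙yz≈y∙xz to ⊕-leftComm)

infixr 25 _·_

_·_ : Bool → F2^ n → F2^ n
c · g = if c then g else 𝟎

·-distribʳ-xor : ∀ a b (g : F2^ n) → (a xor b) · g ≡ a · g ⊕ b · g
·-distribʳ-xor false false g = sym (⊕-identityˡ 𝟎)
·-distribʳ-xor false true  g = sym (⊕-identityˡ g)
·-distribʳ-xor true  false g = sym (⊕-identityʳ g)
·-distribʳ-xor true  true  g = sym (⊕-self g)

combo-⊕ : (gs : Vec (F2^ n) k) (c c′ : F2^ k) → combo gs (c ⊕ c′) ≡ combo gs c ⊕ combo gs c′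
combo-⊕ []       []      []       = sym (⊕-identityˡ 𝟎)
combo-⊕ (g ∷ gs) (a ∷ c) (b ∷ c′) =
  trans (cong₂ _⊕_ (·-distribʳ-xor a b g) (combo-⊕ gs c c′)) (⊕-interchange _ _ _ _)

combo-insertAt : (gs : Vec (F2^ n) (suc k)) (i : Fin (suc k)) (β : Bool) (c : F2^ k) →
                 combo gs (insertAt c i β) ≡ β · lookup gs i ⊕ combo (removeAt gs i) c
combo-insertAt (g ∷ gs)         zero    β c       = refl
combo-insertAt (g ∷ gs@(_ ∷ _)) (suc i) β (x ∷ c) =
  trans (cong (x · g ⊕_) (combo-insertAt gs i β c)) (⊕-leftComm _ _ _)

removeAt-𝟎 : (i : Fin (suc k)) → removeAt (𝟎 {suc k}) i ≡ 𝟎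
removeAt-𝟎 {zero}  zero    = refl
removeAt-𝟎 {suc k} zero    = refl
removeAt-𝟎 {suc k} (suc i) = cong (false ∷_) (removeAt-𝟎 i)

Independent : Vec (F2^ n) k → Set
Independent gs = ∀ c → combo gs c ≡ 𝟎 → c ≡ 𝟎

affine : (b : F2^ n) (gs : Vec (F2^ n) k) → Independent gs → Affine n
affine b gs indep = record { dim = _ ; base = b ; gens = gs ; independent = indep }

point : (V : Affine n) → F2^ (dim V) → F2^ n
point V c = base V ⊕ combo (gens V) c

point-injective : (V : Affine n) {c c′ : F2^ (dim V)} → point V c ≡ point V c′ → c ≡ c′
point-injective V {c} {c′} eq = ⊕≡𝟎⇒≡ c c′ (independent V (c ⊕ c′) (begin
  combo (gens V) (c ⊕ c′)               ≡⟨ combo-⊕ (gens V) c c′ ⟩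
  combo (gens V) c ⊕ combo (gens V) c′  ≡⟨ cong (_⊕ combo (gens V) c′) (⊕-cancelˡ (base V) _ _ eq) ⟩
  combo (gens V) c′ ⊕ combo (gens V) c′ ≡⟨ ⊕-self _ ⟩
  𝟎                                     ∎))
  where open ≡-Reasoning

_≟ᵛ_ : DecidableEquality (F2^ n)
_≟ᵛ_ = ≡-dec _≟ᵇ_

𝟙-∈A : (V : Affine n) (x : F2^ n) → 𝟙 (x ∈A? V) ≡ ∑ (dim V) (λ c → 𝟙 (x ≟ᵛ point V c))
𝟙-∈A V x with x ∈A? V
... | no x∉V = sym (∑-zero (dim V) (λ c → 𝟙-no _ (x∉V ∘ lose (∈-allVecs c))))
... | yes x∈V with satisfied x∈V
...   | c₀ , refl = sym (trans
        (∑-single (dim V) _ c₀ (λ c c≢c₀ → 𝟙-no _ (c≢c₀ ∘ sym ∘ point-injective V)))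
        (𝟙-yes (point V c₀ ≟ᵛ point V c₀) refl))

∑-select : ∀ k (f : F2^ k → ℕ) y → ∑ k (λ x → 𝟙 (x ≟ᵛ y) * f x) ≡ f y
∑-select k f y = begin
  ∑ k (λ x → 𝟙 (x ≟ᵛ y) * f x) ≡⟨ ∑-single k _ y (λ x x≢y → cong (_* f x) (𝟙-no (x ≟ᵛ y) x≢y)) ⟩
  𝟙 (y ≟ᵛ y) * f y             ≡⟨ cong (_* f y) (𝟙-yes (y ≟ᵛ y) refl) ⟩
  1 * f y                      ≡⟨ *-identityˡ (f y) ⟩
  f y                          ∎
  where open ≡-Reasoning

length-filter-map : {P : Pred B ℓ} (P? : Decidable P) (f : A → B) (xs : List A) →
                    length (filter P? (map f xs)) ≡ length (filter (P? ∘ f) xs)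
length-filter-map P? f []       = refl
length-filter-map P? f (x ∷ xs) with P? (f x)
... | yes _ = cong suc (length-filter-map P? f xs)
... | no  _ = length-filter-map P? f xs

length-filter-allVecs : ∀ n {P : Pred (F2^ n) ℓ} (P? : Decidable P) →
                        length (filter P? (allVecs n)) ≡ ∑ n (𝟙 ∘ P?)
length-filter-allVecs zero    P? with P? []
... | yes _ = refl
... | no  _ = refl
length-filter-allVecs (suc n) P? = begin
  length (filter P? (map (false ∷_) (allVecs n) ++ map (true ∷_) (allVecs n)))
    ≡⟨ cong length (filter-++ P? (map (false ∷_) (allVecs n)) _) ⟩
  length (filter P? (map (false ∷_) (allVecs n)) ++ filter P? (map (true ∷_) (allVecs n)))
    ≡⟨ length-++ (filter P? (map (false ∷_) (allVecs n))) ⟩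
  length (filter P? (map (false ∷_) (allVecs n))) + length (filter P? (map (true ∷_) (allVecs n)))
    ≡⟨ cong₂ _+_ (halfCount false) (halfCount true) ⟩
  ∑ (suc n) (𝟙 ∘ P?) ∎
  where
  open ≡-Reasoning
  halfCount : ∀ b → length (filter P? (map (b ∷_) (allVecs n))) ≡ ∑ n (λ x → 𝟙 (P? (b ∷ x)))
  halfCount b = trans (length-filter-map P? (b ∷_) (allVecs n)) (length-filter-allVecs n _)

pointsIn : {P : Pred (F2^ n) ℓ} → Decidable P → Affine n → ℕ
pointsIn P? V = ∑ (dim V) (λ c → 𝟙 (P? (point V c)))

length-filter-∈A : {P : Pred (F2^ n) ℓ} (P? : Decidable P) (V : Affine n) →
                   length (filter (λ x → x ∈A? V ×-dec P? x) (allVecs n)) ≡ pointsIn P? V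
length-filter-∈A {n} P? V = begin
  length (filter (λ x → x ∈A? V ×-dec P? x) (allVecs n))
    ≡⟨ length-filter-allVecs n _ ⟩
  ∑ n (λ x → 𝟙 (x ∈A? V ×-dec P? x))
    ≡⟨ ∑-cong n (λ x → 𝟙-×-dec (x ∈A? V) (P? x)) ⟩
  ∑ n (λ x → 𝟙 (x ∈A? V) * 𝟙 (P? x))
    ≡⟨ ∑-cong n (λ x → cong (_* 𝟙 (P? x)) (𝟙-∈A V x)) ⟩
  ∑ n (λ x → ∑ (dim V) (λ c → 𝟙 (x ≟ᵛ point V c)) * 𝟙 (P? x))
    ≡⟨ ∑-cong n (λ x → ∑-distribʳ-* (dim V) _ (𝟙 (P? x))) ⟩
  ∑ n (λ x → ∑ (dim V) (λ c → 𝟙 (x ≟ᵛ point V c) * 𝟙 (P? x)))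
    ≡⟨ ∑-comm n (dim V) _ ⟩
  ∑ (dim V) (λ c → ∑ n (λ x → 𝟙 (x ≟ᵛ point V c) * 𝟙 (P? x)))
    ≡⟨ ∑-cong (dim V) (λ c → ∑-select n (𝟙 ∘ P?) (point V c)) ⟩
  pointsIn P? V ∎
  where open ≡-Reasoning

card≡2^dim : (V : Affine n) → card V ≡ 2 ^ dim V
card≡2^dim {n} V = begin
  card V
    ≡⟨ cong length (filter-≐ (_∈A? V) (λ x → x ∈A? V ×-dec yes tt) ((_, tt) , proj₁) (allVecs n)) ⟩
  length (filter (λ x → x ∈A? V ×-dec yes tt) (allVecs n))
    ≡⟨ length-filter-∈A (λ _ → yes tt) V ⟩
  ∑ (dim V) (λ _ → 1)
    ≡⟨ ∑-one (dim V) ⟩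
  2 ^ dim V ∎
  where open ≡-Reasoning

removeAt-independent : (gs : Vec (F2^ n) (suc k)) (i : Fin (suc k)) →
                       Independent gs → Independent (removeAt gs i)
removeAt-independent gs i indep c combo≡𝟎 = begin
  c                                ≡⟨ removeAt-insertAt c i false ⟨
  removeAt (insertAt c i false) i  ≡⟨ cong (λ c′ → removeAt c′ i) (indep _ lifted≡𝟎) ⟩
  removeAt 𝟎 i                     ≡⟨ removeAt-𝟎 i ⟩
  𝟎                                ∎
  where
  open ≡-Reasoning
  lifted≡𝟎 : combo gs (insertAt c i false) ≡ 𝟎
  lifted≡𝟎 = trans (combo-insertAt gs i false c) (trans (⊕-identityˡ _) combo≡𝟎)

face : (b : F2^ n) (gs : Vec (F2^ n) (suc k)) → Independent gs → Fin (suc k) → Bool → Affine n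
face b gs indep i β = affine (b ⊕ β · lookup gs i) (removeAt gs i) (removeAt-independent gs i indep)

module _ (b : F2^ n) (gs : Vec (F2^ n) (suc k)) (indep : Independent gs) (i : Fin (suc k)) where

  point-face : ∀ β c → point (affine b gs indep) (insertAt c i β) ≡ point (face b gs indep i β) c
  point-face β c = trans (cong (b ⊕_) (combo-insertAt gs i β c)) (sym (⊕-assoc b _ _))

  module _ {P : Pred (F2^ n) ℓ} (P? : Decidable P) where

    pointsIn-faces : pointsIn P? (affine b gs indep) ≡
                     pointsIn P? (face b gs indep i false) + pointsIn P? (face b gs indep i true)
    pointsIn-faces = trans (∑-insertAt k (λ c → 𝟙 (P? (point (affine b gs indep) c))) i)
      (cong₂ _+_ (∑-cong k (cong (𝟙 ∘ P?) ∘ point-face false)) (∑-cong k (cong (𝟙 ∘ P?) ∘ point-face true)))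

    face-nonempty : ∀ c → P (point (affine b gs indep) c) →
                    pointsIn P? (face b gs indep i (lookup c i)) ≢ 0
    face-nonempty c Pc = term≢0⇒∑≢0 k _ (removeAt c i) λ 𝟙≡0 →
      contradiction (trans (sym (𝟙-yes _ (subst P point≡ Pc))) 𝟙≡0) λ ()
      where
      point≡ : point (affine b gs indep) c ≡ point (face b gs indep i (lookup c i)) (removeAt c i)
      point≡ = trans (cong (point (affine b gs indep)) (sym (insertAt-removeAt c i)))
                     (point-face (lookup c i) (removeAt c i))

    faces-nonempty : ∀ {c₀ c₁} → P (point (affine b gs indep) c₀) → P (point (affine b gs indep) c₁) →
                     lookup c₀ i ≢ lookup c₁ i → ∀ β → pointsIn P? (face b gs indep i β) ≢ 0
    faces-nonempty {c₀} {c₁} Pc₀ Pc₁ c₀ᵢ≢c₁ᵢ β with β ≟ᵇ lookup c₀ i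
    ... | yes refl = face-nonempty c₀ Pc₀
    ... | no  β≢c₀ᵢ = subst (λ γ → pointsIn P? (face b gs indep i γ) ≢ 0) c₁ᵢ≡β (face-nonempty c₁ Pc₁)
      where
      c₁ᵢ≡β : lookup c₁ i ≡ β
      c₁ᵢ≡β = trans (¬-not (c₀ᵢ≢c₁ᵢ ∘ sym)) (sym (¬-not β≢c₀ᵢ))

≢⇒∃lookup≢ : {xs ys : Vec A k} → DecidableEquality A → xs ≢ ys → ∃ λ i → lookup xs i ≢ lookup ys i
≢⇒∃lookup≢ {k = k} {xs} {ys} _≟_ xs≢ys = ¬∀⟶∃¬ k _ (λ i → lookup xs i ≟ lookup ys i) λ pointwise →
  xs≢ys (trans (sym (tabulate∘lookup xs)) (trans (tabulate-cong pointwise) (tabulate∘lookup ys)))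

module _ {P : Pred (F2^ n) ℓ} (P? : Decidable P) where

  pointsIn≡1 : (V : Affine n) {c₀ : F2^ (dim V)} → P (point V c₀) →
               (∀ c → c ≢ c₀ → ¬ P (point V c)) → pointsIn P? V ≡ 1
  pointsIn≡1 V {c₀} Pc₀ unique =
    trans (∑-single (dim V) _ c₀ (λ c c≢c₀ → 𝟙-no _ (unique c c≢c₀))) (𝟙-yes _ Pc₀)

  pointsIn≡1⊎twoPoints : (V : Affine n) → pointsIn P? V ≢ 0 →
                         pointsIn P? V ≡ 1 ⊎ ∃₂ λ c₀ c₁ → c₀ ≢ c₁ × P (point V c₀) × P (point V c₁)
  pointsIn≡1⊎twoPoints V V≢0 with ∑≢0⇒∃ (dim V) _ V≢0
  ... | c₀ , 𝟙≢0 with ∃? (λ c → ¬? (c ≟ᵛ c₀) ×-dec P? (point V c))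
  ...   | yes (c₁ , c₁≢c₀ , Pc₁) = inj₂ (c₀ , c₁ , c₁≢c₀ ∘ sym , 𝟙≢0⇒ _ 𝟙≢0 , Pc₁)
  ...   | no  none = inj₁ (pointsIn≡1 V (𝟙≢0⇒ _ 𝟙≢0) λ c c≢c₀ Pc → none (c , c≢c₀ , Pc))

  module _ (d : ℕ) (isolated⇒dim≤ : ∀ (W : Affine n) → pointsIn P? W ≡ 1 → dim W ≤ d) where

    LowerBound : Affine n → Set
    LowerBound W = pointsIn P? W ≢ 0 → 2 ^ dim W ≤ pointsIn P? W * 2 ^ d

    isolated-bound : (W : Affine n) → pointsIn P? W ≡ 1 → 2 ^ dim W ≤ pointsIn P? W * 2 ^ d
    isolated-bound W W≡1 = begin
      2 ^ dim W            ≤⟨ ^-monoʳ-≤ 2 (isolated⇒dim≤ W W≡1) ⟩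
      2 ^ d                ≡⟨ *-identityˡ (2 ^ d) ⟨
      1 * 2 ^ d            ≡⟨ cong (_* 2 ^ d) W≡1 ⟨
      pointsIn P? W * 2 ^ d ∎
      where open ≤-Reasoning

    halves-bound : (b : F2^ n) (gs : Vec (F2^ n) (suc k)) (indep : Independent gs) (i : Fin (suc k)) →
                   (∀ β → 2 ^ k ≤ pointsIn P? (face b gs indep i β) * 2 ^ d) →
                   2 ^ suc k ≤ pointsIn P? (affine b gs indep) * 2 ^ d
    halves-bound {k = k} b gs indep i halves = begin
      2 ^ suc k                 ≡⟨ cong (_+_ (2 ^ k)) (+-identityʳ (2 ^ k)) ⟩
      2 ^ k + 2 ^ k             ≤⟨ +-mono-≤ (halves false) (halves true) ⟩
      N₀ * 2 ^ d + N₁ * 2 ^ d   ≡⟨ *-distribʳ-+ (2 ^ d) N₀ N₁ ⟨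
      (N₀ + N₁) * 2 ^ d         ≡⟨ cong (_* 2 ^ d) (pointsIn-faces b gs indep i P?) ⟨
      pointsIn P? (affine b gs indep) * 2 ^ d ∎
      where
      open ≤-Reasoning
      N₀ = pointsIn P? (face b gs indep i false)
      N₁ = pointsIn P? (face b gs indep i true)

    bound : ∀ k (b : F2^ n) (gs : Vec (F2^ n) k) (indep : Independent gs) → LowerBound (affine b gs indep)
    bound k b gs indep W≢0 with pointsIn≡1⊎twoPoints (affine b gs indep) W≢0
    bound k       b gs indep W≢0 | inj₁ W≡1 = isolated-bound (affine b gs indep) W≡1
    bound zero    b gs indep W≢0 | inj₂ ([] , [] , []≢[] , _) = contradiction refl []≢[]
    bound (suc k) b gs indep W≢0 | inj₂ (c₀ , c₁ , c₀≢c₁ , Pc₀ , Pc₁) with ≢⇒∃lookup≢ _≟ᵇ_ c₀≢c₁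
    ... | i , c₀ᵢ≢c₁ᵢ = halves-bound b gs indep i λ β →
      bound k _ (removeAt gs i) (removeAt-independent gs i indep)
            (faces-nonempty b gs indep i P? Pc₀ Pc₁ c₀ᵢ≢c₁ᵢ β)

    2^dim≤pointsIn*2^d : (V : Affine n) → LowerBound V
    2^dim≤pointsIn*2^d V = bound (dim V) (base V) (gens V) (independent V)

+m∣i-j⇔+m∣i-j%ℕm : ∀ m .{{_ : NonZero m}} (i j : ℤ) → (+ m ∣ i - j) ⇔ (+ m ∣ i - + (j %ℕ m))
+m∣i-j⇔+m∣i-j%ℕm m i j = mk⇔
  (λ m∣i-j → subst (+ m ∣_) shift (∣m∣n⇒∣m+n m∣i-j m∣q))
  (λ m∣i-r → ∣m+n∣n⇒∣m (subst (+ m ∣_) (sym shift) m∣i-r) m∣q)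
  where
  q = (j /ℕ m) *ℤ + m
  m∣q : + m ∣ q
  m∣q = ∣n⇒∣m*n (j /ℕ m) ∣-refl
  open +-*-Solver
  shift : (i - j) +ℤ q ≡ i - + (j %ℕ m)
  shift = begin
    (i - j) +ℤ q                  ≡⟨ cong (λ j′ → (i - j′) +ℤ q) (a≡a%ℕn+[a/ℕn]*n j m) ⟩
    (i - (+ (j %ℕ m) +ℤ q)) +ℤ q  ≡⟨ solve 3 (λ i r q → (i :- (r :+ q)) :+ q := i :- r) refl i (+ (j %ℕ m)) q ⟩
    i - + (j %ℕ m)                ∎
    where open ≡-Reasoning

N≡N%ℕ : (V : Affine n) (a : ℤ) (M : ℕ) .{{_ : NonZero M}} → N V a M ≡ N V (+ (a %ℕ M)) M
N≡N%ℕ {n} V a M = cong length (filter-≐ _ _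
  ( (λ {x} (x∈V , M∣) → x∈V , Equivalence.to   (+m∣i-j⇔+m∣i-j%ℕm M (+ Ham x) a) M∣)
  , (λ {x} (x∈V , M∣) → x∈V , Equivalence.from (+m∣i-j⇔+m∣i-j%ℕm M (+ Ham x) a) M∣))
  (allVecs n))

proposition4p6 : (n M : ℕ) → .{{_ : NonZero n}} → .{{_ : NonZero M}}
    → (a : ℤ) (V : Affine n) (d : ℕ) → Is𝒟 n M d
    → N V a M ≢ 0
    → card V ≤ N V a M * 2 ^ (d + 1)
proposition4p6 n M a V d (_ , maximal) N≢0 = begin
  card V                      ≡⟨ card≡2^dim V ⟩
  2 ^ dim V                   ≤⟨ 2^dim≤pointsIn*2^d P? d isolated⇒dim≤ V (N≢0 ∘ trans N≡pointsIn) ⟩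
  pointsIn P? V * 2 ^ d       ≤⟨ *-monoʳ-≤ (pointsIn P? V) (^-monoʳ-≤ 2 (m≤m+n d 1)) ⟩
  pointsIn P? V * 2 ^ (d + 1) ≡⟨ cong (_* 2 ^ (d + 1)) N≡pointsIn ⟨
  N V a M * 2 ^ (d + 1)       ∎
  where
  open ≤-Reasoning
  r = a %ℕ M
  P? : Decidable (λ (x : F2^ n) → HamCong x (+ r) M)
  P? x = + M ∣? (+ Ham x - + r)
  N≡pointsIn : N V a M ≡ pointsIn P? V
  N≡pointsIn = trans (N≡N%ℕ V a M) (length-filter-∈A P? V)
  isolated⇒dim≤ : ∀ W → pointsIn P? W ≡ 1 → dim W ≤ d
  isolated⇒dim≤ W W≡1 = maximal W (r , <⇒≤ (n%ℕd<d a M) , trans (length-filter-∈A P? W) W≡1)
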